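{- Let $S[1..n]$ be a string over $\Sigma=\{1,\dots,\sigma\}$ and let $L[1..n]$ be its Burrows--Wheeler transform. Let $\mathcal{T}$ be a VLB-tree built on $L$ with block size $\ell$, branching factor $f$ and run threshold $w$, where $\ell=f^{x}$ and $w=f^{y}$ for integers $x>y$. Then, for every position $i\in[1..n]$, the query $access(L,i)$ (returning $L[i]$) can be answered on $\mathcal{T}$ in $O(\log_f(\ell/w)+w)$ time.
   Context: Model: word RAM; $f\le 64$, so that rank/predecessor/select on bitvectors of length at most $f$ (and on the per-node alphabet bitvectors, assumed to fit in a machine word) take constant time with word operations. $rle(X)$ denotes the run-length encoding of a sequence $X$ as a list of (symbol, length) pairs of maximal equal-symbol runs. For a bitvector $B$, $rank_1(B,i)$ is the number of 1s in $B[1..i]$, $select_1(B,j)$ is the position of the $j$-th 1, $pred_1(B,i)$ is the largest position $\le i$ holding a 1. VLB-tree construction. Split $L$ into $\lceil n/\ell\rceil$ blocks of length $\ell$, processed left to right. If a block has at most $w$ runs, it is greedily concatenated with the following blocks as long as the concatenation has at most $w$ runs; the maximal concatenation becomes a leaf child of the root (a "superblock"). If a block has more than $w$ runs it becomes an internal node, whose fragment is split into $f$ equal-length parts of length $|fragment|/f$, which are processed recursively left to right with the same merge-or-split rule (consecutive parts of the same parent with at most $w$ runs in total merge into one leaf; parts with more than $w$ runs become internal nodes). For a node $u$ with fragment $L^u$ and parent $v$ with fragment $L^v$ over alphabet $\Sigma^v=[1..\sigma^v]$, the symbols of $L^u$ are renamed to a compact alphabet $[1..\sigma^u]$; node $u$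 stores a bitvector $A[1..\sigma^v]$ with $A[c]=1$ iff parent symbol $c$ occurs in $L^u$ (so compact symbol $c'$ corresponds to parent symbol $select_1(A,c')$). A leaf stores the array $E=rle$ of its (compacted) fragment, with at most $w$ runs. An internal node stores a bitvector $X[1..f]$ marking which of its $f$ parts begin a child, and an array $P$ of child pointers; the root stores, for each top-level block $b$, either a pointer to the child starting at block $b$ or the offset to the block where the child covering $b$ starts. $access(L,i)$: compute the top-level block $b=\lceil i/\ell\rceil$, find the root child covering it and the local offset of $i$; at each internal node with part length $\ell_u$, compute $b=\lceil i/\ell_u\rceil$, $o=pred_1(X,b)$, $q=rank_1(X,o)$, set $i\gets i-(o-1)\ell_u$ and go to the $q$-th child; at the leaf, scan $E$ to find the run containing local position $i$, obtaining a compacted symbol; then ascend the visited path applying $c\gets select_1(A,c)$ at each node to recover the original symbol. -}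

module Defs where

open import Data.Nat.Base using (ℕ; zero; suc; _+_; _*_; _∸_; _^_; _≤ᵇ_; _<ᵇ_; _≡ᵇ_; _/_)
open import Data.Bool.Base using (Bool; true; false; if_then_else_; _∧_; _∨_)
open import Data.List.Base using (List; []; _∷_; _++_; length; map; replicate; take; drop; upTo; mapMaybe; last; concatMap; applyUpTo)
open import Data.Bool.ListAction using (any)
open import Data.Maybe.Base using (Maybe; just; nothing)
open import Data.Product.Base using (_×_; _,_)
open import Data.Fin.Base using (Fin; toℕ)

-- Conventions: positions, block indices and symbols are 0-based
-- internally (position i here is position i+1 of the paper, symbol c of
-- Fin σ is the paper's symbol c+1).

lexLeq : List ℕ → List ℕ → Bool
lexLeq []       _        = true
lexLeq (_ ∷ _)  []       = false
lexLeq (a ∷ as) (b ∷ bs) = (a <ᵇ b) ∨ ((a ≡ᵇ b) ∧ lexLeq as bs)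

insertBy : {A : Set} → (A → List ℕ) → A → List A → List A
insertBy key x []       = x ∷ []
insertBy key x (y ∷ ys) =
  if lexLeq (key x) (key y) then x ∷ y ∷ ys else y ∷ insertBy key x ys

sortBy : {A : Set} → (A → List ℕ) → List A → List A
sortBy key []       = []
sortBy key (x ∷ xs) = insertBy key x (sortBy key xs)

rotation : {A : Set} → List A → ℕ → List A
rotation S k = drop k S ++ take k S

rotations : {A : Set} → List A → List (List A)
rotations S = map (rotation S) (upTo (length S))

bwt : {σ : ℕ} → List (Fin σ) → List (Fin σ)
bwt S = mapMaybe last (sortBy (map toℕ) (rotations S))

rle : List ℕ → List (ℕ × ℕ)
rle []       = []
rle (a ∷ xs) with rle xs
... | []            = (a , 1) ∷ []
... | (b , k) ∷ rs  = if a ≡ᵇ b then (b , suc k) ∷ rs else (a , 1) ∷ (b , k) ∷ rs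

runs : List ℕ → ℕ
runs X = length (rle X)

chunkAux : {A : Set} → ℕ → ℕ → List A → List (List A)
chunkAux zero     d xs = []
chunkAux (suc fu) d [] = []
chunkAux (suc fu) d (x ∷ xs) = take d (x ∷ xs) ∷ chunkAux fu d (drop d (x ∷ xs))

chunk : {A : Set} → ℕ → List A → List (List A)
chunk zero    xs = []
chunk (suc d) xs = chunkAux (length xs) (suc d) xs

nth : {A : Set} → List A → ℕ → Maybe A
nth []       _       = nothing
nth (x ∷ xs) zero    = just x
nth (x ∷ xs) (suc i) = nth xs i

div : ℕ → ℕ → ℕ
div m zero    = 0
div m (suc d) = m / suc d

countTrue : List Bool → ℕ
countTrue []           = 0
countTrue (true ∷ bs)  = suc (countTrue bs)
countTrue (false ∷ bs) = countTrue bs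

-- rank₁(B, i): number of 1s in B[0..i] (inclusive, 0-based)
rank1 : List Bool → ℕ → ℕ
rank1 B i = countTrue (take (suc i) B)

-- pred₁(B, i): largest position j ≤ i with B[j] = 1 (0 if none)
predAux : ℕ → List Bool → ℕ → Maybe ℕ
predAux pos []           i = nothing
predAux pos (b ∷ bs)     i =
  if i <ᵇ pos then nothing
  else (if b then (rest (predAux (suc pos) bs i)) else predAux (suc pos) bs i)
  where
  rest : Maybe ℕ → Maybe ℕ
  rest (just j) = just j
  rest nothing  = just pos

pred1 : List Bool → ℕ → ℕ
pred1 B i with predAux 0 B i
... | just j  = j
... | nothing = 0

-- select₁(B, c): position of the (c+1)-th 1 of B (0-based; 0 if none)
select1 : List Bool → ℕ → ℕ
select1 []           c       = 0
select1 (true ∷ bs)  zero    = 0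
select1 (true ∷ bs)  (suc c) = suc (select1 bs c)
select1 (false ∷ bs) c       = suc (select1 bs c)

-- Alphabet compaction.  A[c] = 1 iff parent symbol c occurs in F; the
-- compact name of parent symbol c is the number of 1s of A before c.

occurs : ℕ → List ℕ → Bool
occurs c F = any (c ≡ᵇ_) F

alphaVec : ℕ → List ℕ → List Bool
alphaVec σp F = map (λ c → occurs c F) (upTo σp)

compact : List Bool → List ℕ → List ℕ
compact A F = map (λ c → countTrue (take c A)) F

data Piece : Set where
  leafP  : List ℕ → ℕ → Piece   -- merged fragment, number of parts covered
  splitP : List ℕ → Piece       -- single part with more than w runs

mutual
  grp : ℕ → List (List ℕ) → List Piece
  grp w []       = []
  grp w (b ∷ bs) =
    if runs b ≤ᵇ w then extend w b 1 bs else splitP b ∷ grp w bs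

  extend : ℕ → List ℕ → ℕ → List (List ℕ) → List Piece
  extend w acc k []       = leafP acc k ∷ []
  extend w acc k (b ∷ bs) =
    if runs (acc ++ b) ≤ᵇ w then extend w (acc ++ b) (suc k) bs
    else leafP acc k ∷ grp w (b ∷ bs)

data Node : Set where
  leaf     : (A : List Bool) → (E : List (ℕ × ℕ)) → Node
  internal : (A : List Bool) → (X : List Bool) → (P : List Node) → Node

marks : Piece → List Bool
marks (leafP _ cnt) = true ∷ replicate (cnt ∸ 1) false
marks (splitP _)    = true ∷ []

fragment : Piece → List ℕ
fragment (leafP F _) = F
fragment (splitP F)  = F

-- mkNode f w k σp p : node for piece p (symbols over parent alphabet
-- [0..σp)), whose nominal fragment length is f^k (parts of length f^(k-1)).
mkNode : ℕ → ℕ → ℕ → ℕ → Piece → Node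
mkNode f w k σp (leafP F cnt) =
  let A = alphaVec σp F in leaf A (rle (compact A F))
mkNode f w zero σp (splitP F) =
  let A = alphaVec σp F in leaf A (rle (compact A F))
mkNode f w (suc k) σp (splitP F) =
  let A  = alphaVec σp F
      F' = compact A F
      ps = grp w (chunk (f ^ k) F')
      ms = concatMap marks ps
  in internal A (ms ++ replicate (f ∸ length ms) false)
                (map (mkNode f w k (countTrue A)) ps)

-- Root: for each top-level block, either the child starting there or the
-- offset back to the block where the covering child starts.
data RootEntry : Set where
  start : Node → RootEntry
  cont  : ℕ → RootEntry

VLBTree : Set
VLBTree = List RootEntry

vlbTree : (f x y σ : ℕ) → List ℕ → VLBTree
vlbTree f x y σ L = concatMap entries (grp (f ^ y) (chunk (f ^ x) L))
  where
  entries : Piece → List RootEntry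
  entries p@(leafP _ cnt) = start (mkNode f (f ^ y) x σ p) ∷ applyUpTo (λ o → cont (suc o)) (cnt ∸ 1)
  entries p@(splitP _)    = start (mkNode f (f ^ y) x σ p) ∷ []

-- access(L, i) with an explicit unit-cost count of word-RAM operations:
-- each node visited costs O(1) for descent (block, pred₁, rank₁) and O(1)
-- for the ascent (select₁); scanning E costs one unit per run examined.
-- Results are pairs (symbol, cost).

scan : List (ℕ × ℕ) → ℕ → ℕ × ℕ
scan []             i = 0 , 1
scan ((c , k) ∷ rs) i with i <ᵇ k
... | true  = c , 1
... | false with scan rs (i ∸ k)
...   | (c' , t) = c' , suc t

-- accNode f k u i : symbol (in the alphabet of u's parent) at local
-- position i of u, where u has nominal fragment length f^k.
accNode : ℕ → ℕ → Node → ℕ → ℕ × ℕ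
accNode f k (leaf A E) i with scan E i
... | (c , t) = select1 A c , suc t
accNode f zero (internal A X P) i = 0 , 1
accNode f (suc k) (internal A X P) i with nth P (rank1 X (pred1 X (div i (f ^ k))) ∸ 1)
... | nothing = 0 , 2
... | just u with accNode f k u (i ∸ pred1 X (div i (f ^ k)) * f ^ k)
...   | (c , t) = select1 A c , 2 + t

access : (f x : ℕ) → VLBTree → ℕ → ℕ × ℕ
access f x T i with div i (f ^ x) | nth T (div i (f ^ x))
... | b | just (start u) with accNode f x u (i ∸ b * f ^ x)
...   | (c , t) = c , suc t
access f x T i | b | just (cont o) with nth T (b ∸ o)
... | just (start u) with accNode f x u (i ∸ (b ∸ o) * f ^ x)
...   | (c , t) = c , suc t
access f x T i | b | just (cont o) | _ = 0 , 1
access f x T i | b | nothing = 0 , 1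

{-# OPTIONS --safe #-}
module Submission where

-- A position of L lies in exactly one part at every level of the tree.  The
-- merge-or-split grouping marks the first part of every child in the bitvector X
-- (and in the root table), so pred₁ and rank₁ on X select the child holding the
-- position, and select₁ on the child's alphabet bitvector undoes the compaction of
-- its symbols.  For the cost: a node whose fragment has length at most f^k is split
-- only if it has more than w = f^y runs, which forces k > y.  Hence a descent meets
-- at most x − y internal nodes, each costing 2, and ends in a leaf whose scan examines
-- at most w + 1 runs, for a total of 3 + 2(x − y) + w ≤ 3((x − y) + w).  Nothing about
-- the Burrows–Wheeler transform is used, and f ≤ 64 only justifies the unit costs
-- built into access.

open import Defs
open import Data.Bool.Base using (true; false; T; if_then_else_)
open import Data.Bool.Properties using (T-≡; T-∨)
open import Data.Empty using (⊥-elim)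
open import Data.Fin.Base using (Fin; toℕ; zero; suc)
open import Data.Fin.Properties using (toℕ<n)
open import Data.List.Base
  using (List; []; _∷_; _++_; length; map; replicate; take; drop; concat; concatMap; applyUpTo; upTo; lookup)
open import Data.List.Properties
  using (length-replicate; length-applyUpTo; length-map; length-++; map-++; ++-assoc; ++-identityʳ;
         concat-++; concatMap-++; take++drop≡id; length-take; length-drop; drop-all)
open import Data.Maybe.Base using (just; nothing)
open import Data.Maybe.Properties using (just-injective)
open import Data.Nat.Base
open import Data.Nat.Properties
open import Data.Nat.DivMod using (+-distrib-/-∣ˡ; m*n/n≡m; m<n⇒m/n≡0)
open import Data.Nat.Divisibility using (n∣m*n)
open import Data.Nat.Tactic.RingSolver using (solve-∀)
open import Data.Product.Base using (_×_; _,_; proj₁; proj₂; ∃-syntax)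
open import Data.Sum.Base using (_⊎_; inj₁; inj₂)
open import Function.Base using (_∘′_)
open import Function.Bundles using (Equivalence)
open import Relation.Binary.PropositionalEquality
open import Relation.Nullary using (yes; no)
open import Relation.Nullary.Reflects using (Reflects; ofʸ; ofⁿ; fromEquivalence)

private
  variable
    C : Set

nth-++ˡ : ∀ (xs ys : List C) {i} → i < length xs → nth (xs ++ ys) i ≡ nth xs i
nth-++ˡ (x ∷ xs) ys {zero}  _         = refl
nth-++ˡ (x ∷ xs) ys {suc i} (s≤s i<n) = nth-++ˡ xs ys i<n

nth-++ʳ : ∀ (xs ys : List C) i → nth (xs ++ ys) (length xs + i) ≡ nth ys i
nth-++ʳ []       ys i = refl
nth-++ʳ (x ∷ xs) ys i = nth-++ʳ xs ys i

nth-++⁻ : ∀ (xs ys : List C) i {v} → nth (xs ++ ys) i ≡ just v →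
          (i < length xs × nth xs i ≡ just v) ⊎ ∃[ j ] (i ≡ length xs + j × nth ys j ≡ just v)
nth-++⁻ []       ys i       e = inj₂ (i , refl , e)
nth-++⁻ (x ∷ xs) ys zero    e = inj₁ (s≤s z≤n , e)
nth-++⁻ (x ∷ xs) ys (suc i) e with nth-++⁻ xs ys i e
... | inj₁ (i<n , e′)      = inj₁ (s≤s i<n , e′)
... | inj₂ (j , refl , e′) = inj₂ (j , refl , e′)

nth-just⇒< : ∀ (xs : List C) i {v} → nth xs i ≡ just v → i < length xs
nth-just⇒< (x ∷ xs) zero    e = s≤s z≤n
nth-just⇒< (x ∷ xs) (suc i) e = s≤s (nth-just⇒< xs i e)

nth-map : ∀ {B : Set} (g : C → B) (xs : List C) i {v} → nth xs i ≡ just v → nth (map g xs) i ≡ just (g v)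
nth-map g (x ∷ xs) zero    refl = refl
nth-map g (x ∷ xs) (suc i) e    = nth-map g xs i e

nth-map-++-middle : ∀ {B : Set} (g : C → B) xs x ys → nth (map g (xs ++ x ∷ ys)) (length xs) ≡ just (g x)
nth-map-++-middle g xs x ys = begin
  nth (map g (xs ++ x ∷ ys)) (length xs)        ≡⟨ cong₂ nth (map-++ g xs (x ∷ ys)) index≡ ⟩
  nth (gxs ++ g x ∷ map g ys) (length gxs + 0)  ≡⟨ nth-++ʳ gxs (g x ∷ map g ys) 0 ⟩
  just (g x)                                    ∎
  where
  open ≡-Reasoning
  gxs = map g xs
  index≡ : length xs ≡ length gxs + 0
  index≡ = sym (trans (+-identityʳ (length gxs)) (length-map g xs))

nth-applyUpTo : ∀ (h : ℕ → C) n {i} → i < n → nth (applyUpTo h n) i ≡ just (h i)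
nth-applyUpTo h (suc n) {zero}  _         = refl
nth-applyUpTo h (suc n) {suc i} (s≤s i<n) = nth-applyUpTo (h ∘′ suc) n i<n

nth-replicate : ∀ n (a : C) {i} → i < n → nth (replicate n a) i ≡ just a
nth-replicate (suc n) a {zero}  _         = refl
nth-replicate (suc n) a {suc i} (s≤s i<n) = nth-replicate n a i<n

nth-lookup : ∀ (xs : List C) i → nth xs (toℕ i) ≡ just (lookup xs i)
nth-lookup (x ∷ xs) zero    = refl
nth-lookup (x ∷ xs) (suc i) = nth-lookup xs i

concat-snoc : ∀ (g : List (List C)) b → concat g ++ b ≡ concat (g ++ b ∷ [])
concat-snoc g b = trans (cong (concat g ++_) (sym (++-identityʳ b))) (concat-++ g (b ∷ []))

≡ᵇ-reflects-≡ : ∀ m n → Reflects (m ≡ n) (m ≡ᵇ n)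
≡ᵇ-reflects-≡ m n = fromEquivalence (≡ᵇ⇒≡ m n) (≡⇒≡ᵇ m n)

if-≤ᵇ-elim : ∀ (P : C → Set) m n {x y} → (m ≤ n → P x) → (n < m → P y) → P (if m ≤ᵇ n then x else y)
if-≤ᵇ-elim P m n then-case else-case with m ≤ᵇ n | ≤ᵇ-reflects-≤ m n
... | true  | ofʸ m≤n = then-case m≤n
... | false | ofⁿ m≰n = else-case (≰⇒> m≰n)

div-[m*n+o]≡m : ∀ m {n o} → o < n → div (m * n + o) n ≡ m
div-[m*n+o]≡m m {suc n} {o} o<n = begin
  (m * suc n + o) / suc n        ≡⟨ +-distrib-/-∣ˡ o (n∣m*n m) ⟩
  m * suc n / suc n + o / suc n  ≡⟨ cong₂ _+_ (m*n/n≡m m (suc n)) (m<n⇒m/n≡0 o<n) ⟩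
  m + 0                          ≡⟨ +-identityʳ m ⟩
  m                              ∎
  where open ≡-Reasoning

[m+n]*o+p∸m*o≡n*o+p : ∀ m n o p → (m + n) * o + p ∸ m * o ≡ n * o + p
[m+n]*o+p∸m*o≡n*o+p m n o p = begin
  (m + n) * o + p ∸ m * o      ≡⟨ cong (λ z → z + p ∸ m * o) (*-distribʳ-+ o m n) ⟩
  m * o + n * o + p ∸ m * o    ≡⟨ cong (_∸ m * o) (+-assoc (m * o) (n * o) p) ⟩
  m * o + (n * o + p) ∸ m * o  ≡⟨ m+n∸m≡n (m * o) (n * o + p) ⟩
  n * o + p                    ∎
  where open ≡-Reasoning

^-cancelˡ-< : ∀ f .{{_ : NonZero f}} {m n} → f ^ m < f ^ n → m < n
^-cancelˡ-< f {m} {n} fᵐ<fⁿ with m <? n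
... | yes m<n = m<n
... | no  m≮n = ⊥-elim (<⇒≱ fᵐ<fⁿ (^-monoʳ-≤ f (≮⇒≥ m≮n)))

-- Run-length encoding

decode : List (ℕ × ℕ) → List ℕ
decode []             = []
decode ((c , k) ∷ rs) = replicate k c ++ decode rs

decode-rle : ∀ xs → decode (rle xs) ≡ xs
decode-rle []       = refl
decode-rle (a ∷ xs) with rle xs | decode-rle xs
... | []           | ih = cong (a ∷_) ih
... | (b , k) ∷ rs | ih with a ≡ᵇ b | ≡ᵇ-reflects-≡ a b
...   | true  | ofʸ refl = cong (a ∷_) ih
...   | false | ofⁿ _    = cong (a ∷_) ih

scan-correct : ∀ E i {v} → nth (decode E) i ≡ just v → proj₁ (scan E i) ≡ v
scan-correct ((c , k) ∷ rs) i e with i <ᵇ k | <ᵇ-reflects-< i k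
... | true  | ofʸ i<k = just-injective (begin
  just c                              ≡⟨ nth-replicate k c i<k ⟨
  nth (replicate k c) i               ≡⟨ nth-++ˡ (replicate k c) (decode rs) i<length ⟨
  nth (replicate k c ++ decode rs) i  ≡⟨ e ⟩
  just _                              ∎)
  where
  open ≡-Reasoning
  i<length : i < length (replicate k c)
  i<length = subst (i <_) (sym (length-replicate k)) i<k
... | false | ofⁿ i≮k with nth-++⁻ (replicate k c) (decode rs) i e
...   | inj₁ (i<length , _)  = ⊥-elim (i≮k (subst (i <_) (length-replicate k) i<length))
...   | inj₂ (j , refl , e′) rewrite length-replicate k {c} | m+n∸m≡n k j = scan-correct rs j e′

scan-cost : ∀ E i → proj₂ (scan E i) ≤ suc (length E)
scan-cost []             i = ≤-refl
scan-cost ((c , k) ∷ rs) i with i <ᵇ k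
... | true  = s≤s z≤n
... | false = s≤s (scan-cost rs (i ∸ k))

rle-∷ : ∀ a xs → ∃[ k ] ∃[ rs ] rle (a ∷ xs) ≡ (a , k) ∷ rs
rle-∷ a xs with rle xs
... | []           = 1 , [] , refl
... | (b , k) ∷ rs with a ≡ᵇ b | ≡ᵇ-reflects-≡ a b
...   | true  | ofʸ refl = suc k , rs , refl
...   | false | ofⁿ _    = 1 , (b , k) ∷ rs , refl

runs-∷-≤ : ∀ a xs → runs (a ∷ xs) ≤ suc (runs xs)
runs-∷-≤ a xs with rle xs
... | []           = ≤-refl
... | (b , k) ∷ rs with a ≡ᵇ b
...   | true  = n≤1+n _
...   | false = ≤-refl

runs-∷-≡ : ∀ a xs → runs (a ∷ a ∷ xs) ≡ runs (a ∷ xs)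
runs-∷-≡ a xs with rle-∷ a xs
... | k , rs , e rewrite e with a ≡ᵇ a | ≡ᵇ-reflects-≡ a a
...   | true  | ofʸ _   = refl
...   | false | ofⁿ a≢a = ⊥-elim (a≢a refl)

runs-∷-≢ : ∀ {a b} xs → a ≢ b → runs (a ∷ b ∷ xs) ≡ suc (runs (b ∷ xs))
runs-∷-≢ {a} {b} xs a≢b with rle-∷ b xs
... | k , rs , e rewrite e with a ≡ᵇ b | ≡ᵇ-reflects-≡ a b
...   | true  | ofʸ a≡b = ⊥-elim (a≢b a≡b)
...   | false | ofⁿ _   = refl

runs-≤-length : ∀ xs → runs xs ≤ length xs
runs-≤-length []       = z≤n
runs-≤-length (a ∷ xs) = ≤-trans (runs-∷-≤ a xs) (s≤s (runs-≤-length xs))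

runs-map-≤ : ∀ (g : ℕ → ℕ) xs → runs (map g xs) ≤ runs xs
runs-map-≤ g []           = z≤n
runs-map-≤ g (a ∷ [])     = ≤-refl
runs-map-≤ g (a ∷ b ∷ xs) with runs-map-≤ g (b ∷ xs) | a ≟ b
... | ih | yes refl = begin
  runs (g a ∷ g a ∷ map g xs)  ≡⟨ runs-∷-≡ (g a) (map g xs) ⟩
  runs (map g (a ∷ xs))        ≤⟨ ih ⟩
  runs (a ∷ xs)                ≡⟨ runs-∷-≡ a xs ⟨
  runs (a ∷ a ∷ xs)            ∎
  where open ≤-Reasoning
... | ih | no a≢b   = begin
  runs (g a ∷ map g (b ∷ xs))  ≤⟨ runs-∷-≤ (g a) (map g (b ∷ xs)) ⟩
  suc (runs (map g (b ∷ xs)))  ≤⟨ s≤s ih ⟩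
  suc (runs (b ∷ xs))          ≡⟨ runs-∷-≢ xs a≢b ⟨
  runs (a ∷ b ∷ xs)            ∎
  where open ≤-Reasoning

-- Alphabet compaction

occurs-nth : ∀ F j {v} → nth F j ≡ just v → T (occurs v F)
occurs-nth (a ∷ F) zero    refl = Equivalence.from T-∨ (inj₁ (≡⇒≡ᵇ a a refl))
occurs-nth (a ∷ F) (suc j) e    = Equivalence.from T-∨ (inj₂ (occurs-nth F j e))

nth-alphaVec : ∀ σp F {j v} → nth F j ≡ just v → v < σp → nth (alphaVec σp F) v ≡ just true
nth-alphaVec σp F {j} {v} e v<σp = begin
  nth (map (λ c → occurs c F) (upTo σp)) v  ≡⟨ nth-map _ (upTo σp) v (nth-applyUpTo (λ c → c) σp v<σp) ⟩
  just (occurs v F)                         ≡⟨ cong just (Equivalence.to T-≡ (occurs-nth F j e)) ⟩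
  just true                                 ∎
  where open ≡-Reasoning

select1-countTrue-take : ∀ A c → nth A c ≡ just true → select1 A (countTrue (take c A)) ≡ c
select1-countTrue-take (true ∷ A)  zero    _ = refl
select1-countTrue-take (true ∷ A)  (suc c) e = cong suc (select1-countTrue-take A c e)
select1-countTrue-take (false ∷ A) (suc c) e = cong suc (select1-countTrue-take A c e)

countTrue-take-< : ∀ A c → nth A c ≡ just true → countTrue (take c A) < countTrue A
countTrue-take-< (true ∷ A)  zero    _ = s≤s z≤n
countTrue-take-< (true ∷ A)  (suc c) e = s≤s (countTrue-take-< A c e)
countTrue-take-< (false ∷ A) (suc c) e = countTrue-take-< A c e

predAux-just⇒≤ : ∀ pos B i {j} → predAux pos B i ≡ just j → pos ≤ i
predAux-just⇒≤ pos (b ∷ B) i e with i <ᵇ pos | <ᵇ-reflects-< i pos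
... | false | ofⁿ i≮pos = ≮⇒≥ i≮pos

predAux-< : ∀ pos B i → i < pos → predAux pos B i ≡ nothing
predAux-< pos []      i i<pos = refl
predAux-< pos (b ∷ B) i i<pos with i <ᵇ pos | <ᵇ-reflects-< i pos
... | true  | _         = refl
... | false | ofⁿ i≮pos = ⊥-elim (i≮pos i<pos)

predAux-falses : ∀ pos m B i → i < pos + m → predAux pos (replicate m false ++ B) i ≡ nothing
predAux-falses pos zero    B i i<pos = predAux-< pos B i (subst (i <_) (+-identityʳ pos) i<pos)
predAux-falses pos (suc m) B i i<    with i <ᵇ pos
... | true  = refl
... | false = predAux-falses (suc pos) m B i (subst (i <_) (+-suc pos m) i<)

predAux-++ : ∀ pos Z B i {j} → predAux (pos + length Z) B i ≡ just j → predAux pos (Z ++ B) i ≡ just j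
predAux-++ pos []      B i {j} e = subst (λ p → predAux p B i ≡ just j) (+-identityʳ pos) e
predAux-++ pos (z ∷ Z) B i {j} e
  with predAux (suc pos) (Z ++ B) i
     | predAux-++ (suc pos) Z B i (subst (λ p → predAux p B i ≡ just j) (+-suc pos (length Z)) e)
... | _ | refl with i <ᵇ pos | <ᵇ-reflects-< i pos
...   | true  | ofʸ i<pos = ⊥-elim (<⇒≱ i<pos (≤-trans (m≤m+n pos _) (predAux-just⇒≤ _ B i e)))
...   | false | _ with z
...     | true  = refl
...     | false = refl

predAux-block : ∀ pos m B i → pos ≤ i → i ≤ pos + m → predAux pos (true ∷ replicate m false ++ B) i ≡ just pos
predAux-block pos m B i pos≤i i≤ with i <ᵇ pos | <ᵇ-reflects-< i pos
... | true  | ofʸ i<pos = ⊥-elim (<⇒≱ i<pos pos≤i)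
... | false | _ rewrite predAux-falses (suc pos) m B i (s≤s i≤) = refl

pred1-just : ∀ B i {j} → predAux 0 B i ≡ just j → pred1 B i ≡ j
pred1-just B i e with predAux 0 B i | e
... | just _ | refl = refl

pred1-block : ∀ Z m B {t} → t ≤ m → pred1 (Z ++ true ∷ replicate m false ++ B) (length Z + t) ≡ length Z
pred1-block Z m B {t} t≤m =
  pred1-just (Z ++ true ∷ replicate m false ++ B) (length Z + t)
    (predAux-++ 0 Z _ _ (predAux-block (length Z) m B (length Z + t) (m≤m+n (length Z) t) (+-monoʳ-≤ (length Z) t≤m)))

rank1-at-true : ∀ Z Y → rank1 (Z ++ true ∷ Y) (length Z) ≡ suc (countTrue Z)
rank1-at-true []          Y = refl
rank1-at-true (true ∷ Z)  Y = cong suc (rank1-at-true Z Y)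
rank1-at-true (false ∷ Z) Y = rank1-at-true Z Y

countTrue-falses : ∀ m B → countTrue (replicate m false ++ B) ≡ countTrue B
countTrue-falses zero    B = refl
countTrue-falses (suc m) B = countTrue-falses m B

-- Splitting into parts

data Chunked {C : Set} (d : ℕ) : List (List C) → Set where
  []   : Chunked d []
  cons : ∀ {c cs} → length c ≤ d → length c ≡ d ⊎ cs ≡ [] → Chunked d cs → Chunked d (c ∷ cs)

length-drop-suc-≤ : ∀ d (x : C) xs → length (drop (suc d) (x ∷ xs)) ≤ length xs
length-drop-suc-≤ d x xs = subst (_≤ length xs) (sym (length-drop (suc d) (x ∷ xs))) (m∸n≤m (length xs) d)

concat-chunkAux : ∀ fuel d (xs : List C) → length xs ≤ fuel → concat (chunkAux fuel (suc d) xs) ≡ xs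
concat-chunkAux zero       d []       _         = refl
concat-chunkAux (suc fuel) d []       _         = refl
concat-chunkAux (suc fuel) d (x ∷ xs) (s≤s len) =
  trans (cong (take (suc d) (x ∷ xs) ++_)
              (concat-chunkAux fuel d (drop (suc d) (x ∷ xs)) (≤-trans (length-drop-suc-≤ d x xs) len)))
        (take++drop≡id (suc d) (x ∷ xs))

chunkAux-[] : ∀ fuel d → chunkAux {C} fuel d [] ≡ []
chunkAux-[] zero       d = refl
chunkAux-[] (suc fuel) d = refl

chunkAux-Chunked : ∀ fuel d (xs : List C) → length xs ≤ fuel → Chunked (suc d) (chunkAux fuel (suc d) xs)
chunkAux-Chunked zero       d []       _         = []
chunkAux-Chunked (suc fuel) d []       _         = []
chunkAux-Chunked (suc fuel) d (x ∷ xs) (s≤s len) =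
  cons (subst (_≤ suc d) (sym (length-take (suc d) (x ∷ xs))) (m⊓n≤m (suc d) _)) full-or-last
       (chunkAux-Chunked fuel d (drop (suc d) (x ∷ xs)) (≤-trans (length-drop-suc-≤ d x xs) len))
  where
  full-or-last : length (take (suc d) (x ∷ xs)) ≡ suc d ⊎ chunkAux fuel (suc d) (drop (suc d) (x ∷ xs)) ≡ []
  full-or-last with suc d ≤? length (x ∷ xs)
  ... | yes d≤n = inj₁ (trans (length-take (suc d) (x ∷ xs)) (m≤n⇒m⊓n≡m d≤n))
  ... | no  d≰n rewrite drop-all (suc d) (x ∷ xs) (<⇒≤ (≰⇒> d≰n)) = inj₂ (chunkAux-[] fuel (suc d))

concat-chunk : ∀ d .{{_ : NonZero d}} (xs : List C) → concat (chunk d xs) ≡ xs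
concat-chunk (suc d) xs = concat-chunkAux (length xs) d xs ≤-refl

chunk-Chunked : ∀ d .{{_ : NonZero d}} (xs : List C) → Chunked d (chunk d xs)
chunk-Chunked (suc d) xs = chunkAux-Chunked (length xs) d xs ≤-refl

Chunked-prefix : ∀ {d} (cs cs′ : List (List C)) → Chunked d (cs ++ cs′) → Chunked d cs
Chunked-prefix []            cs′ _              = []
Chunked-prefix (c ∷ [])      cs′ (cons c≤d _ _) = cons c≤d (inj₂ refl) []
Chunked-prefix (c ∷ c′ ∷ cs) cs′ (cons c≤d (inj₁ c≡d) ch) =
  cons c≤d (inj₁ c≡d) (Chunked-prefix (c′ ∷ cs) cs′ ch)

Chunked-suffix : ∀ {d} (cs cs′ : List (List C)) → Chunked d (cs ++ cs′) → Chunked d cs′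
Chunked-suffix []       cs′ ch            = ch
Chunked-suffix (c ∷ cs) cs′ (cons _ _ ch) = Chunked-suffix cs cs′ ch

Chunked-nth : ∀ {d} cs b r {c} {v : C} → Chunked d cs → nth cs b ≡ just c → nth c r ≡ just v →
              nth (concat cs) (b * d + r) ≡ just v
Chunked-nth (c ∷ cs) zero r ch refl e = trans (nth-++ˡ c (concat cs) (nth-just⇒< c r e)) e
Chunked-nth {d = d} (c ∷ c′ ∷ cs) (suc b) r (cons _ (inj₁ c≡d) ch) e₁ e₂ = begin
  nth (c ++ rest) (d + b * d + r)           ≡⟨ cong (nth (c ++ rest)) (+-assoc d (b * d) r) ⟩
  nth (c ++ rest) (d + (b * d + r))         ≡⟨ cong (λ n → nth (c ++ rest) (n + (b * d + r))) c≡d ⟨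
  nth (c ++ rest) (length c + (b * d + r))  ≡⟨ nth-++ʳ c rest (b * d + r) ⟩
  nth rest (b * d + r)                      ≡⟨ Chunked-nth (c′ ∷ cs) b r ch e₁ e₂ ⟩
  just _                                    ∎
  where
  open ≡-Reasoning
  rest = concat (c′ ∷ cs)

Chunked-locate : ∀ {d} cs i {v : C} → Chunked d cs → nth (concat cs) i ≡ just v →
                 ∃[ b ] ∃[ r ] ∃[ c ] i ≡ b * d + r × r < d × nth cs b ≡ just c × nth c r ≡ just v
Chunked-locate (c ∷ cs) i (cons c≤d full-or-last ch) e with nth-++⁻ c (concat cs) i e
... | inj₁ (i<c , e′) = 0 , i , c , refl , ≤-trans i<c c≤d , refl , e′
... | inj₂ (j , refl , e′) with full-or-last
Chunked-locate (c ∷ []) i _ e | inj₂ (j , refl , ()) | inj₂ refl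
...   | inj₁ refl with Chunked-locate cs j ch e′
...     | b , r , c′ , refl , r<d , e₁ , e₂ =
  suc b , r , c′ , sym (+-assoc (length c) (b * length c) r) , r<d , e₁ , e₂

-- Merge-or-split grouping

partCount : Piece → ℕ
partCount (leafP _ k) = k
partCount (splitP _)  = 1

marks-shape : ∀ p → marks p ≡ true ∷ replicate (partCount p ∸ 1) false
marks-shape (leafP _ _) = refl
marks-shape (splitP _)  = refl

WellFormed : ℕ → ℕ → Piece → Set
WellFormed w d (leafP F _) = runs F ≤ w
WellFormed w d (splitP F)  = w < runs F × length F ≤ d

data Cover (w : ℕ) : List Piece → List (List ℕ) → Set where
  []    : Cover w [] []
  leaf  : ∀ {ps cs} c g → runs (concat (c ∷ g)) ≤ w → Cover w ps cs →
          Cover w (leafP (concat (c ∷ g)) (suc (length g)) ∷ ps) (c ∷ g ++ cs)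
  split : ∀ {ps cs} c → w < runs c → Cover w ps cs → Cover w (splitP c ∷ ps) (c ∷ cs)

mutual
  grp-Cover : ∀ w cs → Cover w (grp w cs) cs
  grp-Cover w []       = []
  grp-Cover w (c ∷ cs) = if-≤ᵇ-elim (λ ps → Cover w ps (c ∷ cs)) (runs c) w
    (extend-Cover w c [] cs (sym (++-identityʳ c)) refl)
    (λ w<c → split c w<c (grp-Cover w cs))

  extend-Cover : ∀ w {acc k} c g cs → acc ≡ concat (c ∷ g) → k ≡ suc (length g) → runs acc ≤ w →
                 Cover w (extend w acc k cs) (c ∷ g ++ cs)
  extend-Cover w c g []       refl refl acc≤w = leaf c g acc≤w []
  extend-Cover w c g (b ∷ cs) refl refl acc≤w =
    if-≤ᵇ-elim (λ ps → Cover w ps (c ∷ g ++ b ∷ cs)) (runs acc′) w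
      (λ acc′≤w → subst (λ bs → Cover w (extend w acc′ (2 + length g) cs) (c ∷ bs))
                    (++-assoc g (b ∷ []) cs)
                    (extend-Cover w c (g ++ b ∷ []) cs (concat-snoc (c ∷ g) b) length-snoc acc′≤w))
      (λ _ → leaf c g acc≤w (grp-Cover w (b ∷ cs)))
    where
    acc′ = concat (c ∷ g) ++ b
    length-snoc : suc (suc (length g)) ≡ suc (length (g ++ b ∷ []))
    length-snoc = cong suc (sym (trans (length-++ g) (+-comm (length g) 1)))

-- Symbol r of part b is v, and part b is part number `offset` of `piece`.
record Located (w d : ℕ) (ps : List Piece) (b r v : ℕ) : Set where
  constructor located
  field
    before  : List Piece
    piece   : Piece
    after   : List Piece
    offset  : ℕ
    pieces≡ : ps ≡ before ++ piece ∷ after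
    block≡  : b ≡ length (concatMap marks before) + offset
    offset≤ : offset ≤ partCount piece ∸ 1
    wf      : WellFormed w d piece
    hit     : nth (fragment piece) (offset * d + r) ≡ just v

Located-∷ : ∀ {w d ps b r v} p → Located w d ps b r v → Located w d (p ∷ ps) (length (marks p) + b) r v
Located-∷ p (located before piece after t refl refl t≤ wf hit) =
  located (p ∷ before) piece after t refl
    (sym (trans (cong (_+ t) (length-++ (marks p))) (+-assoc (length (marks p)) _ t))) t≤ wf hit

Cover-locate : ∀ {w d ps cs} b r {c v} → Cover w ps cs → Chunked d cs → nth cs b ≡ just c → nth c r ≡ just v →
               Located w d ps b r v
Cover-locate {w} {d} {p ∷ ps} b r {v = v} (leaf c g runs≤w cover) ch e₁ e₂ with nth-++⁻ (c ∷ g) _ b e₁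
... | inj₁ (b<n , e₁′) =
  located [] p ps b refl refl (≤-pred b<n) runs≤w (Chunked-nth (c ∷ g) b r (Chunked-prefix (c ∷ g) _ ch) e₁′ e₂)
... | inj₂ (j , refl , e₁′) =
  subst (λ b → Located w d (p ∷ ps) b r v) (cong suc (cong (_+ j) (length-replicate (length g))))
    (Located-∷ p (Cover-locate j r cover (Chunked-suffix (c ∷ g) _ ch) e₁′ e₂))
Cover-locate zero    r (split c w<c cover) (cons c≤d _ _) refl e₂ = located [] _ _ 0 refl refl z≤n (w<c , c≤d) e₂
Cover-locate (suc b) r (split c w<c cover) (cons _ _ ch)  e₁   e₂ = Located-∷ _ (Cover-locate b r cover ch e₁ e₂)

locate : ∀ w d .{{_ : NonZero d}} xs {i v} → nth xs i ≡ just v →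
         ∃[ b ] ∃[ r ] i ≡ b * d + r × r < d × Located w d (grp w (chunk d xs)) b r v
locate w d xs {i} {v} e
  with Chunked-locate (chunk d xs) i (chunk-Chunked d xs) (subst (λ ys → nth ys i ≡ just v) (sym (concat-chunk d xs)) e)
... | b , r , c , i≡ , r<d , e₁ , e₂ =
  b , r , i≡ , r<d , Cover-locate b r (grp-Cover w (chunk d xs)) (chunk-Chunked d xs) e₁ e₂

countTrue-marks : ∀ ps → countTrue (concatMap marks ps) ≡ length ps
countTrue-marks []               = refl
countTrue-marks (leafP _ k ∷ ps) = cong suc (trans (countTrue-falses (k ∸ 1) _) (countTrue-marks ps))
countTrue-marks (splitP _ ∷ ps)  = cong suc (countTrue-marks ps)

concatMap-marks-++ : ∀ ps₁ p ps₂ Z → concatMap marks (ps₁ ++ p ∷ ps₂) ++ Z ≡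
                     concatMap marks ps₁ ++ true ∷ replicate (partCount p ∸ 1) false ++ concatMap marks ps₂ ++ Z
concatMap-marks-++ ps₁ p ps₂ Z = begin
  concatMap marks (ps₁ ++ p ∷ ps₂) ++ Z              ≡⟨ cong (_++ Z) (concatMap-++ marks ps₁ (p ∷ ps₂)) ⟩
  (M₁ ++ marks p ++ M₂) ++ Z                         ≡⟨ ++-assoc M₁ (marks p ++ M₂) Z ⟩
  M₁ ++ (marks p ++ M₂) ++ Z                         ≡⟨ cong (λ m → M₁ ++ (m ++ M₂) ++ Z) (marks-shape p) ⟩
  M₁ ++ true ∷ (falses ++ M₂) ++ Z                   ≡⟨ cong (λ m → M₁ ++ true ∷ m) (++-assoc falses M₂ Z) ⟩
  M₁ ++ true ∷ falses ++ M₂ ++ Z                     ∎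
  where
  open ≡-Reasoning
  M₁ = concatMap marks ps₁
  M₂ = concatMap marks ps₂
  falses = replicate (partCount p ∸ 1) false

pred1-marks : ∀ ps₁ p ps₂ Z {t} → t ≤ partCount p ∸ 1 →
              pred1 (concatMap marks (ps₁ ++ p ∷ ps₂) ++ Z) (length (concatMap marks ps₁) + t)
                ≡ length (concatMap marks ps₁)
pred1-marks ps₁ p ps₂ Z t≤ rewrite concatMap-marks-++ ps₁ p ps₂ Z =
  pred1-block (concatMap marks ps₁) (partCount p ∸ 1) (concatMap marks ps₂ ++ Z) t≤

rank1-marks : ∀ ps₁ p ps₂ Z →
              rank1 (concatMap marks (ps₁ ++ p ∷ ps₂) ++ Z) (length (concatMap marks ps₁)) ≡ suc (length ps₁)
rank1-marks ps₁ p ps₂ Z rewrite concatMap-marks-++ ps₁ p ps₂ Z =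
  trans (rank1-at-true (concatMap marks ps₁) _) (cong suc (countTrue-marks ps₁))

accNode-internal≡ : ∀ f k A X P j {u j′} → nth P (rank1 X (pred1 X (div j (f ^ k))) ∸ 1) ≡ just u →
                    j ∸ pred1 X (div j (f ^ k)) * f ^ k ≡ j′ →
                    accNode f (suc k) (internal A X P) j ≡
                    (select1 A (proj₁ (accNode f k u j′)) , 2 + proj₂ (accNode f k u j′))
accNode-internal≡ f k A X P j e refl rewrite e = refl

accNode-Located : ∀ f k A Z (g : Piece → Node) {w ps j b r v} → j ≡ b * f ^ k + r → r < f ^ k →
  (loc : Located w (f ^ k) ps b r v) →
  let res = accNode f k (g (Located.piece loc)) (Located.offset loc * f ^ k + r) in
  accNode f (suc k) (internal A (concatMap marks ps ++ Z) (map g ps)) j ≡ (select1 A (proj₁ res) , 2 + proj₂ res)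
accNode-Located f k A Z g {r = r} refl r<d (located ps₁ p ps₂ t refl refl t≤ _ _) =
  accNode-internal≡ f k A X P j child local
  where
  open ≡-Reasoning
  d = f ^ k
  o = length (concatMap marks ps₁)
  X = concatMap marks (ps₁ ++ p ∷ ps₂) ++ Z
  P = map g (ps₁ ++ p ∷ ps₂)
  j = (o + t) * d + r
  pred≡ : pred1 X (div j d) ≡ o
  pred≡ = trans (cong (pred1 X) (div-[m*n+o]≡m (o + t) r<d)) (pred1-marks ps₁ p ps₂ Z t≤)
  child : nth P (rank1 X (pred1 X (div j d)) ∸ 1) ≡ just (g p)
  child = begin
    nth P (rank1 X (pred1 X (div j d)) ∸ 1)  ≡⟨ cong (λ o′ → nth P (rank1 X o′ ∸ 1)) pred≡ ⟩
    nth P (rank1 X o ∸ 1)                    ≡⟨ cong (λ q → nth P (q ∸ 1)) (rank1-marks ps₁ p ps₂ Z) ⟩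
    nth P (length ps₁)                       ≡⟨ nth-map-++-middle g ps₁ p ps₂ ⟩
    just (g p)                               ∎
  local : j ∸ pred1 X (div j d) * d ≡ t * d + r
  local = trans (cong (λ o′ → j ∸ o′ * d) pred≡) ([m+n]*o+p∸m*o≡n*o+p o t d r)

RootEntries : (Piece → Node) → (Piece → List RootEntry) → Set
RootEntries mk ent = ∀ p → ent p ≡ start (mk p) ∷ applyUpTo (λ o → cont (suc o)) (partCount p ∸ 1)

-- The root table is built by a function local to vlbTree, so it is only available existentially.
vlbTree-entries : ∀ f x y σ L → ∃[ ent ] vlbTree f x y σ L ≡ concatMap ent (grp (f ^ y) (chunk (f ^ x) L))
                                        × RootEntries (mkNode f (f ^ y) x σ) ent
vlbTree-entries f x y σ L = _ , refl , λ { (leafP _ _) → refl ; (splitP _) → refl }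

module _ {mk : Piece → Node} {ent : Piece → List RootEntry} (shape : RootEntries mk ent) where

  length-concatMap-entries : ∀ ps → length (concatMap ent ps) ≡ length (concatMap marks ps)
  length-concatMap-entries []       = refl
  length-concatMap-entries (p ∷ ps) = begin
    length (ent p ++ concatMap ent ps)              ≡⟨ length-++ (ent p) ⟩
    length (ent p) + length (concatMap ent ps)      ≡⟨ cong₂ _+_ length-entry (length-concatMap-entries ps) ⟩
    length (marks p) + length (concatMap marks ps)  ≡⟨ length-++ (marks p) ⟨
    length (marks p ++ concatMap marks ps)          ∎
    where
    open ≡-Reasoning
    length-entry : length (ent p) ≡ length (marks p)
    length-entry rewrite shape p | marks-shape p =
      cong suc (trans (length-applyUpTo _ (partCount p ∸ 1)) (sym (length-replicate (partCount p ∸ 1))))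

  nth-concatMap-entries : ∀ ps₁ p ps₂ t →
    nth (concatMap ent (ps₁ ++ p ∷ ps₂)) (length (concatMap marks ps₁) + t) ≡ nth (ent p ++ concatMap ent ps₂) t
  nth-concatMap-entries ps₁ p ps₂ t
    rewrite concatMap-++ ent ps₁ (p ∷ ps₂) | sym (length-concatMap-entries ps₁) = nth-++ʳ (concatMap ent ps₁) _ t

  nth-entry-start : ∀ p E → nth (ent p ++ E) 0 ≡ just (start (mk p))
  nth-entry-start p E rewrite shape p = refl

  nth-entry-cont : ∀ p E {t} → suc t ≤ partCount p ∸ 1 → nth (ent p ++ E) (suc t) ≡ just (cont (suc t))
  nth-entry-cont p E {t} t< rewrite shape p = begin
    nth (conts ++ E) t   ≡⟨ nth-++ˡ conts E (subst (t <_) (sym (length-applyUpTo _ m)) t<) ⟩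
    nth conts t          ≡⟨ nth-applyUpTo (λ o → cont (suc o)) m t< ⟩
    just (cont (suc t))  ∎
    where
    open ≡-Reasoning
    m = partCount p ∸ 1
    conts = applyUpTo (λ o → cont (suc o)) m

access-start≡ : ∀ f x tree i {b u j′} → div i (f ^ x) ≡ b → nth tree b ≡ just (start u) →
                i ∸ b * f ^ x ≡ j′ →
                access f x tree i ≡ (proj₁ (accNode f x u j′) , suc (proj₂ (accNode f x u j′)))
access-start≡ f x tree i refl e refl rewrite e = refl

access-cont≡ : ∀ f x tree i {b s u j′} → div i (f ^ x) ≡ b → nth tree b ≡ just (cont s) →
               nth tree (b ∸ s) ≡ just (start u) → i ∸ (b ∸ s) * f ^ x ≡ j′ →
               access f x tree i ≡ (proj₁ (accNode f x u j′) , suc (proj₂ (accNode f x u j′)))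
access-cont≡ f x tree i refl e₁ e₂ refl rewrite e₁ | e₂ = refl

access-Located : ∀ f x {mk ent} → RootEntries mk ent → ∀ {w ps i b r v} → i ≡ b * f ^ x + r → r < f ^ x →
  (loc : Located w (f ^ x) ps b r v) →
  let res = accNode f x (mk (Located.piece loc)) (Located.offset loc * f ^ x + r) in
  access f x (concatMap ent ps) i ≡ (proj₁ res , suc (proj₂ res))
access-Located f x {mk} {ent} shape {r = r} refl r<D (located ps₁ p ps₂ t refl refl t≤ _ _) = by-offset t t≤
  where
  D = f ^ x
  o = length (concatMap marks ps₁)
  tree = concatMap ent (ps₁ ++ p ∷ ps₂)
  entry : ∀ t → nth tree (o + t) ≡ nth (ent p ++ concatMap ent ps₂) t
  entry = nth-concatMap-entries shape ps₁ p ps₂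
  start≡ : nth tree o ≡ just (start (mk p))
  start≡ = trans (cong (nth tree) (sym (+-identityʳ o))) (trans (entry 0) (nth-entry-start shape p _))
  by-offset : ∀ t → t ≤ partCount p ∸ 1 →
    let res = accNode f x (mk p) (t * D + r) in access f x tree ((o + t) * D + r) ≡ (proj₁ res , suc (proj₂ res))
  by-offset zero    _  = access-start≡ f x tree _ (div-[m*n+o]≡m (o + 0) r<D)
    (trans (entry 0) (nth-entry-start shape p _)) (m+n∸m≡n ((o + 0) * D) r)
  by-offset (suc t) t< = access-cont≡ f x tree _ (div-[m*n+o]≡m (o + suc t) r<D)
    (trans (entry (suc t)) (nth-entry-cont shape p _ t<))
    (trans (cong (nth tree) (m+n∸n≡m o (suc t))) start≡)
    (trans (cong (λ b → (o + suc t) * D + r ∸ b * D) (m+n∸n≡m o (suc t))) ([m+n]*o+p∸m*o≡n*o+p o (suc t) D r))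

-- Correctness and cost of access

Answers : ℕ → ℕ → ℕ × ℕ → Set
Answers v budget res = proj₁ res ≡ v × proj₂ res ≤ budget

accNode-leaf : ∀ f k σp F {j v} → nth F j ≡ just v → v < σp →
               Answers v (2 + runs F) (accNode f k (leaf (alphaVec σp F) (rle (compact (alphaVec σp F) F))) j)
accNode-leaf f k σp F {j} {v} e v<σp =
  trans (cong (select1 A) (scan-correct E j decoded)) (select1-countTrue-take A v (nth-alphaVec σp F e v<σp)) ,
  s≤s (≤-trans (scan-cost E j) (s≤s (runs-map-≤ _ F)))
  where
  A = alphaVec σp F
  E = rle (compact A F)
  decoded : nth (decode E) j ≡ just (countTrue (take v A))
  decoded rewrite decode-rle (compact A F) = nth-map _ F j e

module _ (f y : ℕ) .{{_ : NonZero f}} where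

  private
    w = f ^ y

  split-level : ∀ k F → WellFormed w (f ^ k) (splitP F) → y < k
  split-level k F (w<runs , length≤) = ^-cancelˡ-< f (<-≤-trans w<runs (≤-trans (runs-≤-length F) length≤))

  budget-suc : ∀ {k} → y ≤ k → 2 + 2 * (suc k ∸ y) + w ≡ 2 + (2 + 2 * (k ∸ y) + w)
  budget-suc {k} y≤k =
    trans (cong (λ n → 2 + 2 * n + w) (+-∸-assoc 1 y≤k)) (cong (λ n → 2 + n + w) (*-suc 2 (k ∸ y)))

  accNode-split : ∀ k σp F {j v B} → nth F j ≡ just v → v < σp →
    (∀ σ′ p {j′ v′} → WellFormed w (f ^ k) p → nth (fragment p) j′ ≡ just v′ → v′ < σ′ →
       Answers v′ B (accNode f k (mkNode f w k σ′ p) j′)) →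
    Answers v (2 + B) (accNode f (suc k) (mkNode f w (suc k) σp (splitP F)) j)
  accNode-split k σp F {j} {v} {B} e v<σp children
    with locate w (f ^ k) {{m^n≢0 f k}} (compact (alphaVec σp F) F) (nth-map _ F j e)
  ... | b , r , j≡ , r<d , loc =
    subst (Answers v (2 + B)) (sym (accNode-Located f k A _ (mkNode f w k (countTrue A)) j≡ r<d loc))
      (trans (cong (select1 A) (proj₁ child)) (select1-countTrue-take A v occurs-v) , +-monoʳ-≤ 2 (proj₂ child))
    where
    A = alphaVec σp F
    occurs-v : nth A v ≡ just true
    occurs-v = nth-alphaVec σp F e v<σp
    child = children (countTrue A) (Located.piece loc) (Located.wf loc) (Located.hit loc) (countTrue-take-< A v occurs-v)

  accNode-mkNode : ∀ k σp p {j v} → WellFormed w (f ^ k) p → nth (fragment p) j ≡ just v → v < σp →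
                   Answers v (2 + 2 * (k ∸ y) + w) (accNode f k (mkNode f w k σp p) j)
  accNode-mkNode k σp (leafP F _) runs≤w e v<σp with accNode-leaf f k σp F e v<σp
  ... | ok , cost≤ = ok , ≤-trans cost≤ (s≤s (s≤s (≤-trans runs≤w (m≤n+m w (2 * (k ∸ y))))))
  accNode-mkNode zero    σp (splitP F) wf e v<σp = ⊥-elim (n≮0 (split-level 0 F wf))
  accNode-mkNode (suc k) σp (splitP F) {j} {v} wf e v<σp =
    subst (λ B → Answers v B (accNode f (suc k) (mkNode f w (suc k) σp (splitP F)) j))
      (sym (budget-suc (≤-pred (split-level (suc k) F wf))))
      (accNode-split k σp F e v<σp (accNode-mkNode k))

  access-vlbTree : ∀ x σ L {i v} → nth L i ≡ just v → v < σ →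
                   Answers v (3 + 2 * (x ∸ y) + w) (access f x (vlbTree f x y σ L) i)
  access-vlbTree x σ L {i} {v} e v<σ with vlbTree-entries f x y σ L | locate w (f ^ x) {{m^n≢0 f x}} L e
  ... | ent , tree≡ , shape | b , r , i≡ , r<D , loc rewrite tree≡ =
    subst (Answers v _) (sym (access-Located f x shape i≡ r<D loc)) (proj₁ node , s≤s (proj₂ node))
    where
    node = accNode-mkNode x σ (Located.piece loc) (Located.wf loc) (Located.hit loc) v<σ

budget-≤ : ∀ {a w} → 1 ≤ a → 1 ≤ w → 3 + 2 * a + w ≤ 3 * (a + w)
budget-≤ {suc a} {suc w} _ _ = begin
  3 + 2 * suc a + suc w  ≡⟨ lhs≡ a w ⟩
  6 + (2 * a + w)        ≤⟨ +-monoʳ-≤ 6 (+-mono-≤ (*-monoˡ-≤ a (n≤1+n 2)) (m≤n*m w 3)) ⟩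
  6 + (3 * a + 3 * w)    ≡⟨ rhs≡ a w ⟨
  3 * (suc a + suc w)    ∎
  where
  open ≤-Reasoning
  lhs≡ : ∀ a w → 3 + 2 * suc a + suc w ≡ 6 + (2 * a + w)
  lhs≡ = solve-∀
  rhs≡ : ∀ a w → 3 * (suc a + suc w) ≡ 6 + (3 * a + 3 * w)
  rhs≡ = solve-∀

access-bound : ∀ f x y σ L {i v} → 2 ≤ f → y < x → nth L i ≡ just v → v < σ →
               Answers v (3 * ((x ∸ y) + f ^ y)) (access f x (vlbTree f x y σ L) i)
access-bound f x y σ L 2≤f y<x e v<σ =
  proj₁ answer , ≤-trans (proj₂ answer) (budget-≤ (m<n⇒0<n∸m y<x) (m^n>0 f y))
  where
  instance
    f≢0 : NonZero f
    f≢0 = >-nonZero (<-≤-trans z<s 2≤f)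
  answer = access-vlbTree f y x σ L e v<σ

theorem3p2 : ∃[ C ] ((σ : ℕ) (S : List (Fin σ)) (f x y : ℕ) →
    2 ≤ f → f ≤ 64 → y < x →
    (i : Fin (length (bwt S))) →
    proj₁ (access f x (vlbTree f x y σ (map toℕ (bwt S))) (toℕ i)) ≡ toℕ (lookup (bwt S) i)
    × proj₂ (access f x (vlbTree f x y σ (map toℕ (bwt S))) (toℕ i)) ≤ C * ((x ∸ y) + f ^ y))
theorem3p2 = 3 , λ σ S f x y 2≤f _ y<x i →
  access-bound f x y σ (map toℕ (bwt S)) 2≤f y<x
    (nth-map toℕ (bwt S) (toℕ i) (nth-lookup (bwt S) i)) (toℕ<n (lookup (bwt S) i))
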